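{- Let $m,k$ be positive integers and $t$ a nonnegative integer. Then \[ \frac{(\Delta^tP_k^m)(l)}{t!}=\sum_{i_1+\dots+i_m=t}\ \prod_{j=1}^m\frac{(\Delta^{i_j}P_k)(l-i_{j+1}-\dots-i_m)}{i_j!}=\sum_{i_1+\dots+i_m=t}\hbar^t\prod_{j=1}^m\frac{(k)_{i_j}}{i_j!}\,P_{k-i_j}(l-i_{j+1}-\dots-i_m), \] where the sums run over ordered tuples of nonnegative integers $(i_1,\dots,i_m)$.
   Context: $P_k(l)=\prod_{i=0}^{k-1}(1+\hbar(l+i+\frac12))$ (a polynomial in $\hbar$ and $l$); $(\Delta f)(l)=f(l)-f(l-1)$. $(a)_b=a(a-1)\cdots(a-b+1)$ is the falling factorial ($(a)_0=1$); terms with some $i_j>k$ vanish since then $(k)_{i_j}=0$. -}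

module Defs where

open import Data.Nat as ℕ using (ℕ; zero; suc; _∸_; _!)
open import Data.Nat.Properties using (_!≢0)
open import Data.Integer using (+_)
open import Data.Rational using (ℚ; 0ℚ; 1ℚ; _+_; _*_; _-_; _/_; ½)
open import Data.List using (List; []; _∷_; map; concatMap; upTo; foldr)
open import Data.Vec using (Vec; []; _∷_)

ι : ℕ → ℚ
ι n = + n / 1

invFact : ℕ → ℚ
invFact n = (+ 1 / (n !)) {{n !≢0}}

pow : ℚ → ℕ → ℚ
pow x zero    = 1ℚ
pow x (suc n) = pow x n * x

-- P_k(l) = ∏_{i=0}^{k-1} (1 + ħ (l + i + 1/2)), evaluated at ħ = h
P : ℚ → ℕ → ℚ → ℚ
P h zero    l = 1ℚ
P h (suc k) l = P h k l * (1ℚ + h * (l + ι k + ½))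

Δ : (ℚ → ℚ) → ℚ → ℚ
Δ f l = f l - f (l - 1ℚ)

Δ^ : ℕ → (ℚ → ℚ) → ℚ → ℚ
Δ^ zero    f = f
Δ^ (suc t) f = Δ (Δ^ t f)

ff : ℕ → ℕ → ℕ
ff a zero    = 1
ff a (suc b) = ff a b ℕ.* (a ∸ b)

sumℕVec : ∀ {m} → Vec ℕ m → ℕ
sumℕVec []       = 0
sumℕVec (x ∷ xs) = x ℕ.+ sumℕVec xs

comps : (m t : ℕ) → List (Vec ℕ m)
comps zero    zero    = [] ∷ []
comps zero    (suc t) = []
comps (suc m) t = concatMap (λ i → map (i ∷_) (comps m (t ∸ i))) (upTo (suc t))

sumℚ : List ℚ → ℚ
sumℚ = foldr _+_ 0ℚ

prodTuple : (ℕ → ℚ → ℚ) → ∀ {m} → Vec ℕ m → ℚ → ℚ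
prodTuple g []       l = 1ℚ
prodTuple g (i ∷ is) l = g i (l - ι (sumℕVec is)) * prodTuple g is l

sumComps : (m t : ℕ) → (ℕ → ℚ → ℚ) → ℚ → ℚ
sumComps m t g l = sumℚ (map (λ is → prodTuple g is l) (comps m t))

-- Write Δ! t f = Δ^t f / t!. From (t + 1) Δ! (t + 1) F (l) = Δ! t F (l) − Δ! t F (l − 1) one gets,
-- by induction on t, the discrete Leibniz rule Δ! t (g f)(l) = Σ_{i+j=t} Δ! i f (l − j) Δ! j g (l);
-- applied to P_k^m = P_k^{m−1} P_k it gives the first equality by induction on m.
-- For the second, P_{j+1}(y − 1) = (1 + ħ (y − 1/2)) P_j(y) yields Δ P_{j+1} = ħ (j + 1) P_j, hence
-- Δ^i P_k = ħ^i (k)_i P_{k−i}, and the powers of ħ in a product over a tuple multiply to ħ^t.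

module Submission where

open import Data.Integer as ℤ using (+_)
import Data.Integer.Properties as ℤP
open import Data.List as List using (List; []; _∷_; _++_; map; concatMap; upTo; applyUpTo)
import Data.List.Properties as ListP
open import Data.List.Relation.Unary.All as All using (All; []; _∷_)
import Data.List.Relation.Unary.All.Properties as All
open import Data.Nat as ℕ using (ℕ; zero; suc; _∸_; _!; _<_; NonZero)
import Data.Nat.Properties as ℕP
open import Data.Nat.Tactic.RingSolver using (solve)
open import Data.Product using (_×_; _,_)
open import Data.Rational using (ℚ; 0ℚ; 1ℚ; _+_; _*_; _-_; _/_; ½; toℚᵘ)
import Data.Rational.Properties as ℚP
open import Data.Rational.Solver using (module +-*-Solver)
open import Data.Rational.Unnormalised as ℚᵘ using (mkℚᵘ; *≡*)
import Data.Rational.Unnormalised.Properties as ℚᵘP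
open import Data.Vec using (Vec; []; _∷_)
open import Relation.Binary.PropositionalEquality
open import Defs

open +-*-Solver using (con; _:+_; _:-_; _:*_; _:=_) renaming (solve to ring)

toℚᵘ-ι : ∀ n → toℚᵘ (ι n) ℚᵘ.≃ mkℚᵘ (+ n) 0
toℚᵘ-ι n = ℚP.toℚᵘ-fromℚᵘ (mkℚᵘ (+ n) 0)

ι-+ : ∀ m n → ι (m ℕ.+ n) ≡ ι m + ι n
ι-+ m n = ℚP.toℚᵘ-injective (begin
    toℚᵘ (ι (m ℕ.+ n))              ≈⟨ toℚᵘ-ι (m ℕ.+ n) ⟩
    mkℚᵘ (+ (m ℕ.+ n)) 0            ≈⟨ *≡* (cong (ℤ._* + 1) +[m+n]≡+m+n) ⟩
    mkℚᵘ (+ m) 0 ℚᵘ.+ mkℚᵘ (+ n) 0  ≈⟨ ℚᵘP.+-cong (toℚᵘ-ι m) (toℚᵘ-ι n) ⟨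
    toℚᵘ (ι m) ℚᵘ.+ toℚᵘ (ι n)      ≈⟨ ℚP.toℚᵘ-homo-+ (ι m) (ι n) ⟨
    toℚᵘ (ι m + ι n)                ∎)
  where
  open ℚᵘP.≃-Reasoning
  +[m+n]≡+m+n : + (m ℕ.+ n) ≡ + m ℤ.* + 1 ℤ.+ + n ℤ.* + 1
  +[m+n]≡+m+n = trans (ℤP.pos-+ m n)
    (sym (cong₂ ℤ._+_ (ℤP.*-identityʳ (+ m)) (ℤP.*-identityʳ (+ n))))

ι-* : ∀ m n → ι (m ℕ.* n) ≡ ι m * ι n
ι-* m n = ℚP.toℚᵘ-injective (begin
    toℚᵘ (ι (m ℕ.* n))              ≈⟨ toℚᵘ-ι (m ℕ.* n) ⟩
    mkℚᵘ (+ (m ℕ.* n)) 0            ≈⟨ *≡* (cong (ℤ._* + 1) (ℤP.pos-* m n)) ⟩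
    mkℚᵘ (+ m) 0 ℚᵘ.* mkℚᵘ (+ n) 0  ≈⟨ ℚᵘP.*-cong (toℚᵘ-ι m) (toℚᵘ-ι n) ⟨
    toℚᵘ (ι m) ℚᵘ.* toℚᵘ (ι n)      ≈⟨ ℚP.toℚᵘ-homo-* (ι m) (ι n) ⟨
    toℚᵘ (ι m * ι n)                ∎)
  where open ℚᵘP.≃-Reasoning

ι-suc : ∀ n → ι (suc n) ≡ 1ℚ + ι n
ι-suc = ι-+ 1

1/[m*n]*m≡1/n : ∀ m n .{{_ : NonZero m}} .{{_ : NonZero n}} →
                (+ 1 / (m ℕ.* n)) {{ℕP.m*n≢0 m n}} * ι m ≡ + 1 / n
1/[m*n]*m≡1/n (suc m) (suc n) = ℚP.toℚᵘ-injective (begin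
    toℚᵘ (1/[m*n] * ι (suc m))                           ≈⟨ ℚP.toℚᵘ-homo-* 1/[m*n] (ι (suc m)) ⟩
    toℚᵘ 1/[m*n] ℚᵘ.* toℚᵘ (ι (suc m))                   ≈⟨ ℚᵘP.*-cong (ℚP.toℚᵘ-fromℚᵘ (mkℚᵘ (+ 1) (n ℕ.+ m ℕ.* suc n)))
                                                                        (toℚᵘ-ι (suc m)) ⟩
    mkℚᵘ (+ 1) (n ℕ.+ m ℕ.* suc n) ℚᵘ.* mkℚᵘ (+ suc m) 0 ≈⟨ *≡* (cong +_ (solve (m List.∷ n List.∷ List.[]))) ⟩
    mkℚᵘ (+ 1) n                                         ≈⟨ ℚP.toℚᵘ-fromℚᵘ (mkℚᵘ (+ 1) n) ⟨
    toℚᵘ (+ 1 / suc n)                                   ∎)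
  where
  open ℚᵘP.≃-Reasoning
  1/[m*n] : ℚ
  1/[m*n] = + 1 / (suc m ℕ.* suc n)

invFact-suc : ∀ t → invFact (suc t) * ι (suc t) ≡ invFact t
invFact-suc t = 1/[m*n]*m≡1/n (suc t) (t !) {{_}} {{ℕP._!≢0 t}}

*-cancelˡ-ι-suc : ∀ n {x y} → ι (suc n) * x ≡ ι (suc n) * y → x ≡ y
*-cancelˡ-ι-suc n {x} {y} nx≡ny = begin
    x                              ≡⟨ ℚP.*-identityˡ x ⟨
    1ℚ * x                         ≡⟨ cong (_* x) (1/[m*n]*m≡1/n (suc n) 1) ⟨
    (1/[1+n] * ι (suc n)) * x      ≡⟨ ℚP.*-assoc 1/[1+n] (ι (suc n)) x ⟩
    1/[1+n] * (ι (suc n) * x)      ≡⟨ cong (1/[1+n] *_) nx≡ny ⟩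
    1/[1+n] * (ι (suc n) * y)      ≡⟨ ℚP.*-assoc 1/[1+n] (ι (suc n)) y ⟨
    (1/[1+n] * ι (suc n)) * y      ≡⟨ cong (_* y) (1/[m*n]*m≡1/n (suc n) 1) ⟩
    1ℚ * y                         ≡⟨ ℚP.*-identityˡ y ⟩
    y                              ∎
  where
  open ≡-Reasoning
  1/[1+n] : ℚ
  1/[1+n] = + 1 / (suc n ℕ.* 1)

Δ! : ℕ → (ℚ → ℚ) → ℚ → ℚ
Δ! t f l = Δ^ t f l * invFact t

ι-suc-*-Δ!-suc : ∀ t f l → ι (suc t) * Δ! (suc t) f l ≡ Δ! t f l - Δ! t f (l - 1ℚ)
ι-suc-*-Δ!-suc t f l = begin
    ι (suc t) * ((u - v) * invFact (suc t))
  ≡⟨ ring 4 (λ c u v w → c :* ((u :- v) :* w) := (u :- v) :* (w :* c)) refl (ι (suc t)) u v (invFact (suc t)) ⟩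
    (u - v) * (invFact (suc t) * ι (suc t))
  ≡⟨ cong ((u - v) *_) (invFact-suc t) ⟩
    (u - v) * invFact t
  ≡⟨ ring 3 (λ u v w → (u :- v) :* w := u :* w :- v :* w) refl u v (invFact t) ⟩
    u * invFact t - v * invFact t
  ∎
  where
  open ≡-Reasoning
  u v : ℚ
  u = Δ^ t f l
  v = Δ^ t f (l - 1ℚ)

Δ^-suc-const : ∀ t c y → Δ^ (suc t) (λ _ → c) y ≡ 0ℚ
Δ^-suc-const zero    c y = ℚP.+-inverseʳ c
Δ^-suc-const (suc t) c y = cong₂ _-_ (Δ^-suc-const t c y) (Δ^-suc-const t c (y - 1ℚ))

P-suc-shift : ∀ h j y → P h (suc j) (y - 1ℚ) ≡ (1ℚ + h * (y - 1ℚ + ½)) * P h j y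
P-suc-shift h zero y =
  ring 3 (λ h y c → con 1ℚ :* (con 1ℚ :+ h :* (y :- con 1ℚ :+ con 0ℚ :+ c))
                    := (con 1ℚ :+ h :* (y :- con 1ℚ :+ c)) :* con 1ℚ) refl h y ½
P-suc-shift h (suc j) y = begin
    P h (suc j) (y - 1ℚ) * (1ℚ + h * (y - 1ℚ + ι (suc j) + ½))
  ≡⟨ cong₂ (λ u v → u * (1ℚ + h * (y - 1ℚ + v + ½))) (P-suc-shift h j y) (ι-suc j) ⟩
    ((1ℚ + h * (y - 1ℚ + ½)) * P h j y) * (1ℚ + h * (y - 1ℚ + (1ℚ + ι j) + ½))
  ≡⟨ ring 5 (λ h y c p n → ((con 1ℚ :+ h :* (y :- con 1ℚ :+ c)) :* p) :* (con 1ℚ :+ h :* (y :- con 1ℚ :+ (con 1ℚ :+ n) :+ c))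
                           := (con 1ℚ :+ h :* (y :- con 1ℚ :+ c)) :* (p :* (con 1ℚ :+ h :* (y :+ n :+ c))))
          refl h y ½ (P h j y) (ι j) ⟩
    (1ℚ + h * (y - 1ℚ + ½)) * (P h j y * (1ℚ + h * (y + ι j + ½)))
  ∎
  where open ≡-Reasoning

Δ-P : ∀ h k y → Δ (P h k) y ≡ h * ι k * P h (ℕ.pred k) y
Δ-P h zero    y = ring 1 (λ h → con 1ℚ :- con 1ℚ := h :* con 0ℚ :* con 1ℚ) refl h
Δ-P h (suc j) y = begin
    P h j y * (1ℚ + h * (y + ι j + ½)) - P h (suc j) (y - 1ℚ)
  ≡⟨ cong (P h j y * (1ℚ + h * (y + ι j + ½)) -_) (P-suc-shift h j y) ⟩
    P h j y * (1ℚ + h * (y + ι j + ½)) - (1ℚ + h * (y - 1ℚ + ½)) * P h j y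
  ≡⟨ ring 5 (λ h y c p n → p :* (con 1ℚ :+ h :* (y :+ n :+ c)) :- (con 1ℚ :+ h :* (y :- con 1ℚ :+ c)) :* p
                           := h :* (con 1ℚ :+ n) :* p) refl h y ½ (P h j y) (ι j) ⟩
    h * (1ℚ + ι j) * P h j y
  ≡⟨ cong (λ n → h * n * P h j y) (ι-suc j) ⟨
    h * ι (suc j) * P h j y
  ∎
  where open ≡-Reasoning

Δ^-P : ∀ h k i y → Δ^ i (P h k) y ≡ pow h i * ι (ff k i) * P h (k ∸ i) y
Δ^-P h k zero    y = ring 1 (λ p → p := con 1ℚ :* con 1ℚ :* p) refl (P h k y)
Δ^-P h k (suc i) y = begin
    Δ^ i (P h k) y - Δ^ i (P h k) (y - 1ℚ)
  ≡⟨ cong₂ _-_ (Δ^-P h k i y) (Δ^-P h k i (y - 1ℚ)) ⟩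
    c * P h (k ∸ i) y - c * P h (k ∸ i) (y - 1ℚ)
  ≡⟨ ring 3 (λ c a b → c :* a :- c :* b := c :* (a :- b)) refl c (P h (k ∸ i) y) (P h (k ∸ i) (y - 1ℚ)) ⟩
    c * Δ (P h (k ∸ i)) y
  ≡⟨ cong (c *_) (Δ-P h (k ∸ i) y) ⟩
    c * (h * ι (k ∸ i) * P h (ℕ.pred (k ∸ i)) y)
  ≡⟨ cong (λ n → c * (h * ι (k ∸ i) * P h n y)) (ℕP.pred[m∸n]≡m∸[1+n] k i) ⟩
    c * (h * ι (k ∸ i) * P h (k ∸ suc i) y)
  ≡⟨ ring 5 (λ a b h n p → (a :* b) :* (h :* n :* p) := (a :* h) :* (b :* n) :* p)
          refl (pow h i) (ι (ff k i)) h (ι (k ∸ i)) (P h (k ∸ suc i) y) ⟩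
    pow h (suc i) * (ι (ff k i) * ι (k ∸ i)) * P h (k ∸ suc i) y
  ≡⟨ cong (λ n → pow h (suc i) * n * P h (k ∸ suc i) y) (ι-* (ff k i) (k ∸ i)) ⟨
    pow h (suc i) * ι (ff k (suc i)) * P h (k ∸ suc i) y
  ∎
  where
  open ≡-Reasoning
  c : ℚ
  c = pow h i * ι (ff k i)

antidiagonalSum : (ℕ → ℕ → ℚ) → ℕ → ℚ
antidiagonalSum F zero    = F 0 0
antidiagonalSum F (suc t) = F 0 (suc t) + antidiagonalSum (λ i j → F (suc i) j) t

antidiagonalSum-cong : ∀ F G t → (∀ i j → i ℕ.+ j ≡ t → F i j ≡ G i j) →
                       antidiagonalSum F t ≡ antidiagonalSum G t
antidiagonalSum-cong F G zero    F≡G = F≡G 0 0 refl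
antidiagonalSum-cong F G (suc t) F≡G = cong₂ _+_ (F≡G 0 (suc t) refl)
  (antidiagonalSum-cong (λ i j → F (suc i) j) (λ i j → G (suc i) j) t (λ i j e → F≡G (suc i) j (cong suc e)))

antidiagonalSum-+ : ∀ F G t → antidiagonalSum (λ i j → F i j + G i j) t ≡ antidiagonalSum F t + antidiagonalSum G t
antidiagonalSum-+ F G zero    = refl
antidiagonalSum-+ F G (suc t) = begin
    F 0 (suc t) + G 0 (suc t) + antidiagonalSum (λ i j → F (suc i) j + G (suc i) j) t
  ≡⟨ cong (_+_ (F 0 (suc t) + G 0 (suc t))) (antidiagonalSum-+ (λ i j → F (suc i) j) (λ i j → G (suc i) j) t) ⟩
    F 0 (suc t) + G 0 (suc t) + (ΣF + ΣG)
  ≡⟨ ring 4 (λ a b c d → a :+ b :+ (c :+ d) := a :+ c :+ (b :+ d)) refl (F 0 (suc t)) (G 0 (suc t)) ΣF ΣG ⟩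
    F 0 (suc t) + ΣF + (G 0 (suc t) + ΣG)
  ∎
  where
  open ≡-Reasoning
  ΣF ΣG : ℚ
  ΣF = antidiagonalSum (λ i j → F (suc i) j) t
  ΣG = antidiagonalSum (λ i j → G (suc i) j) t

antidiagonalSum-- : ∀ F G t → antidiagonalSum (λ i j → F i j - G i j) t ≡ antidiagonalSum F t - antidiagonalSum G t
antidiagonalSum-- F G zero    = refl
antidiagonalSum-- F G (suc t) = begin
    (F 0 (suc t) - G 0 (suc t)) + antidiagonalSum (λ i j → F (suc i) j - G (suc i) j) t
  ≡⟨ cong (_+_ (F 0 (suc t) - G 0 (suc t))) (antidiagonalSum-- (λ i j → F (suc i) j) (λ i j → G (suc i) j) t) ⟩
    (F 0 (suc t) - G 0 (suc t)) + (ΣF - ΣG)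
  ≡⟨ ring 4 (λ a b c d → (a :- b) :+ (c :- d) := (a :+ c) :- (b :+ d)) refl (F 0 (suc t)) (G 0 (suc t)) ΣF ΣG ⟩
    F 0 (suc t) + ΣF - (G 0 (suc t) + ΣG)
  ∎
  where
  open ≡-Reasoning
  ΣF ΣG : ℚ
  ΣF = antidiagonalSum (λ i j → F (suc i) j) t
  ΣG = antidiagonalSum (λ i j → G (suc i) j) t

antidiagonalSum-*ˡ : ∀ c F t → antidiagonalSum (λ i j → c * F i j) t ≡ c * antidiagonalSum F t
antidiagonalSum-*ˡ c F zero    = refl
antidiagonalSum-*ˡ c F (suc t) = trans
  (cong (_+_ (c * F 0 (suc t))) (antidiagonalSum-*ˡ c (λ i j → F (suc i) j) t))
  (sym (ℚP.*-distribˡ-+ c (F 0 (suc t)) (antidiagonalSum (λ i j → F (suc i) j) t)))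

antidiagonalSum-unfoldʳ : ∀ F t → antidiagonalSum F (suc t) ≡ antidiagonalSum (λ i j → F i (suc j)) t + F (suc t) 0
antidiagonalSum-unfoldʳ F zero    = refl
antidiagonalSum-unfoldʳ F (suc t) = trans
  (cong (_+_ (F 0 (suc (suc t)))) (antidiagonalSum-unfoldʳ (λ i j → F (suc i) j) t))
  (sym (ℚP.+-assoc (F 0 (suc (suc t))) (antidiagonalSum (λ i j → F (suc i) (suc j)) t) (F (suc (suc t)) 0)))

-- Reindexing turns the two sums into sums over i + j = t + 1 weighted by i and by j
-- (the new boundary terms have weight 0); together the weight is i + j = t + 1.
antidiagonalSum-weighted : ∀ A t →
  antidiagonalSum (λ i j → ι (suc i) * A (suc i) j + ι (suc j) * A i (suc j)) t ≡ ι (suc t) * antidiagonalSum A (suc t)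
antidiagonalSum-weighted A t = begin
    antidiagonalSum (λ i j → ι (suc i) * A (suc i) j + ι (suc j) * A i (suc j)) t
  ≡⟨ antidiagonalSum-+ (λ i j → ι (suc i) * A (suc i) j) (λ i j → ι (suc j) * A i (suc j)) t ⟩
    Σᵢ + Σⱼ
  ≡⟨ cong₂ _+_ weighted-by-i weighted-by-j ⟨
    antidiagonalSum (λ i j → ι i * A i j) (suc t) + antidiagonalSum (λ i j → ι j * A i j) (suc t)
  ≡⟨ antidiagonalSum-+ (λ i j → ι i * A i j) (λ i j → ι j * A i j) (suc t) ⟨
    antidiagonalSum (λ i j → ι i * A i j + ι j * A i j) (suc t)
  ≡⟨ antidiagonalSum-cong _ _ (suc t) i+j-weight ⟩
    antidiagonalSum (λ i j → ι (suc t) * A i j) (suc t)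
  ≡⟨ antidiagonalSum-*ˡ (ι (suc t)) A (suc t) ⟩
    ι (suc t) * antidiagonalSum A (suc t)
  ∎
  where
  open ≡-Reasoning
  Σᵢ Σⱼ : ℚ
  Σᵢ = antidiagonalSum (λ i j → ι (suc i) * A (suc i) j) t
  Σⱼ = antidiagonalSum (λ i j → ι (suc j) * A i (suc j)) t
  weighted-by-i : antidiagonalSum (λ i j → ι i * A i j) (suc t) ≡ Σᵢ
  weighted-by-i = trans (cong (_+ Σᵢ) (ℚP.*-zeroˡ (A 0 (suc t)))) (ℚP.+-identityˡ Σᵢ)
  weighted-by-j : antidiagonalSum (λ i j → ι j * A i j) (suc t) ≡ Σⱼ
  weighted-by-j = trans (antidiagonalSum-unfoldʳ (λ i j → ι j * A i j) t)
                        (trans (cong (_+_ Σⱼ) (ℚP.*-zeroˡ (A (suc t) 0))) (ℚP.+-identityʳ Σⱼ))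
  i+j-weight : ∀ i j → i ℕ.+ j ≡ suc t → ι i * A i j + ι j * A i j ≡ ι (suc t) * A i j
  i+j-weight i j i+j≡1+t = trans (sym (ℚP.*-distribʳ-+ (A i j) (ι i) (ι j)))
                                 (cong (_* A i j) (trans (sym (ι-+ i j)) (cong ι i+j≡1+t)))

Δ!-product-step : ∀ f g l i j →
  Δ! i f (l - ι j) * Δ! j g l - Δ! i f ((l - 1ℚ) - ι j) * Δ! j g (l - 1ℚ)
    ≡ ι (suc i) * (Δ! (suc i) f (l - ι j) * Δ! j g l) + ι (suc j) * (Δ! i f (l - ι (suc j)) * Δ! (suc j) g l)
Δ!-product-step f g l i j = begin
    a * b - Δ! i f ((l - 1ℚ) - ι j) * b′
  ≡⟨ cong (λ x → a * b - Δ! i f x * b′) (ring 2 (λ l n → (l :- con 1ℚ) :- n := (l :- n) :- con 1ℚ) refl l (ι j)) ⟩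
    a * b - a′ * b′
  ≡⟨ ring 4 (λ a a′ b b′ → a :* b :- a′ :* b′ := (a :- a′) :* b :+ a′ :* (b :- b′)) refl a a′ b b′ ⟩
    (a - a′) * b + a′ * (b - b′)
  ≡⟨ cong₂ (λ x y → x * b + a′ * y) (ι-suc-*-Δ!-suc i f (l - ι j)) (ι-suc-*-Δ!-suc j g l) ⟨
    (ι (suc i) * Δ! (suc i) f (l - ι j)) * b + a′ * (ι (suc j) * Δ! (suc j) g l)
  ≡⟨ cong (λ x → (ι (suc i) * Δ! (suc i) f (l - ι j)) * b + Δ! i f x * (ι (suc j) * Δ! (suc j) g l)) l-ι[1+j]≡l-ι[j]-1 ⟨
    (ι (suc i) * Δ! (suc i) f (l - ι j)) * b + Δ! i f (l - ι (suc j)) * (ι (suc j) * Δ! (suc j) g l)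
  ≡⟨ ring 6 (λ x y b z w d → (x :* y) :* b :+ z :* (w :* d) := x :* (y :* b) :+ w :* (z :* d))
          refl (ι (suc i)) (Δ! (suc i) f (l - ι j)) b (Δ! i f (l - ι (suc j))) (ι (suc j)) (Δ! (suc j) g l) ⟩
    ι (suc i) * (Δ! (suc i) f (l - ι j) * b) + ι (suc j) * (Δ! i f (l - ι (suc j)) * Δ! (suc j) g l)
  ∎
  where
  open ≡-Reasoning
  a a′ b b′ : ℚ
  a  = Δ! i f (l - ι j)
  a′ = Δ! i f ((l - ι j) - 1ℚ)
  b  = Δ! j g l
  b′ = Δ! j g (l - 1ℚ)
  l-ι[1+j]≡l-ι[j]-1 : l - ι (suc j) ≡ (l - ι j) - 1ℚ
  l-ι[1+j]≡l-ι[j]-1 = trans (cong (l -_) (ι-suc j)) (ring 2 (λ l n → l :- (con 1ℚ :+ n) := (l :- n) :- con 1ℚ) refl l (ι j))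

-- Δ(u v)(l) = Δu(l) v(l) + u(l − 1) Δv(l): every difference taken of g shifts the argument of
-- the f-factor by one, whence l − j.
Δ!-leibniz : ∀ t f g l → Δ! t (λ x → g x * f x) l ≡ antidiagonalSum (λ i j → Δ! i f (l - ι j) * Δ! j g l) t
Δ!-leibniz zero    f g l = trans
  (ring 2 (λ a b → (b :* a) :* con 1ℚ := (a :* con 1ℚ) :* (b :* con 1ℚ)) refl (f l) (g l))
  (cong (λ x → (f x * 1ℚ) * (g l * 1ℚ)) (sym (ℚP.+-identityʳ l)))
Δ!-leibniz (suc t) f g l = *-cancelˡ-ι-suc t (begin
    ι (suc t) * Δ! (suc t) gf l
  ≡⟨ ι-suc-*-Δ!-suc t gf l ⟩
    Δ! t gf l - Δ! t gf (l - 1ℚ)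
  ≡⟨ cong₂ _-_ (Δ!-leibniz t f g l) (Δ!-leibniz t f g (l - 1ℚ)) ⟩
    antidiagonalSum (A l) t - antidiagonalSum (A (l - 1ℚ)) t
  ≡⟨ antidiagonalSum-- (A l) (A (l - 1ℚ)) t ⟨
    antidiagonalSum (λ i j → A l i j - A (l - 1ℚ) i j) t
  ≡⟨ antidiagonalSum-cong _ _ t (λ i j _ → Δ!-product-step f g l i j) ⟩
    antidiagonalSum (λ i j → ι (suc i) * A l (suc i) j + ι (suc j) * A l i (suc j)) t
  ≡⟨ antidiagonalSum-weighted (A l) t ⟩
    ι (suc t) * antidiagonalSum (A l) (suc t)
  ∎)
  where
  open ≡-Reasoning
  gf : ℚ → ℚ
  gf x = g x * f x
  A : ℚ → ℕ → ℕ → ℚ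
  A y i j = Δ! i f (y - ι j) * Δ! j g y

sumℚ-++ : ∀ xs ys → sumℚ (xs ++ ys) ≡ sumℚ xs + sumℚ ys
sumℚ-++ []       ys = sym (ℚP.+-identityˡ (sumℚ ys))
sumℚ-++ (x ∷ xs) ys = trans (cong (_+_ x) (sumℚ-++ xs ys)) (sym (ℚP.+-assoc x (sumℚ xs) (sumℚ ys)))

sumℚ-map-concatMap : ∀ {A B : Set} (f : B → ℚ) (H : A → List B) xs →
                     sumℚ (map f (concatMap H xs)) ≡ sumℚ (map (λ x → sumℚ (map f (H x))) xs)
sumℚ-map-concatMap f H []       = refl
sumℚ-map-concatMap f H (x ∷ xs) = begin
    sumℚ (map f (H x ++ concatMap H xs))
  ≡⟨ cong sumℚ (ListP.map-++ f (H x) (concatMap H xs)) ⟩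
    sumℚ (map f (H x) ++ map f (concatMap H xs))
  ≡⟨ sumℚ-++ (map f (H x)) (map f (concatMap H xs)) ⟩
    sumℚ (map f (H x)) + sumℚ (map f (concatMap H xs))
  ≡⟨ cong (_+_ (sumℚ (map f (H x)))) (sumℚ-map-concatMap f H xs) ⟩
    sumℚ (map f (H x)) + sumℚ (map (λ x → sumℚ (map f (H x))) xs)
  ∎
  where open ≡-Reasoning

sumℚ-map-*ˡ : ∀ {A : Set} c (f : A → ℚ) xs → sumℚ (map (λ x → c * f x) xs) ≡ c * sumℚ (map f xs)
sumℚ-map-*ˡ c f []       = sym (ℚP.*-zeroʳ c)
sumℚ-map-*ˡ c f (x ∷ xs) =
  trans (cong (_+_ (c * f x)) (sumℚ-map-*ˡ c f xs)) (sym (ℚP.*-distribˡ-+ c (f x) (sumℚ (map f xs))))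

sumℚ-applyUpTo≡antidiagonalSum : ∀ G t → sumℚ (applyUpTo (λ i → G i (t ∸ i)) (suc t)) ≡ antidiagonalSum G t
sumℚ-applyUpTo≡antidiagonalSum G zero    = ℚP.+-identityʳ (G 0 0)
sumℚ-applyUpTo≡antidiagonalSum G (suc t) = cong (_+_ (G 0 (suc t))) (sumℚ-applyUpTo≡antidiagonalSum (λ i j → G (suc i) j) t)

comps-sum : ∀ m t → All (λ is → sumℕVec is ≡ t) (comps m t)
comps-sum zero    zero    = refl ∷ []
comps-sum zero    (suc t) = []
comps-sum (suc m) t = All.concat⁺ (All.map⁺ (All.applyUpTo⁺₁ _ (suc t) λ {i} i<1+t →
  All.map⁺ (All.map (λ Σis≡t∸i → trans (cong (i ℕ.+_) Σis≡t∸i) (ℕP.m+[n∸m]≡n (ℕP.≤-pred i<1+t))) (comps-sum m (t ∸ i)))))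

-- Splitting off i₁ = i leaves tuples summing to s = t − i, and the first factor is evaluated at l − s.
sumComps-suc : ∀ g l m t → sumComps (suc m) t g l ≡ antidiagonalSum (λ i s → g i (l - ι s) * sumComps m s g l) t
sumComps-suc g l m t = begin
    sumℚ (map term (concatMap tuplesStartingWith (upTo (suc t))))
  ≡⟨ sumℚ-map-concatMap term tuplesStartingWith (upTo (suc t)) ⟩
    sumℚ (map (λ i → sumℚ (map term (tuplesStartingWith i))) (upTo (suc t)))
  ≡⟨ cong sumℚ (ListP.map-upTo (λ i → sumℚ (map term (tuplesStartingWith i))) (suc t)) ⟩
    sumℚ (applyUpTo (λ i → sumℚ (map term (map (i ∷_) (comps m (t ∸ i))))) (suc t))
  ≡⟨ sumℚ-applyUpTo≡antidiagonalSum (λ i s → sumℚ (map term (map (i ∷_) (comps m s)))) t ⟩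
    antidiagonalSum (λ i s → sumℚ (map term (map (i ∷_) (comps m s)))) t
  ≡⟨ antidiagonalSum-cong _ _ t (λ i s _ → first-index i s) ⟩
    antidiagonalSum (λ i s → g i (l - ι s) * sumComps m s g l) t
  ∎
  where
  open ≡-Reasoning
  term : Vec ℕ (suc m) → ℚ
  term is = prodTuple g is l
  tuplesStartingWith : ℕ → List (Vec ℕ (suc m))
  tuplesStartingWith i = map (i ∷_) (comps m (t ∸ i))
  first-index : ∀ i s → sumℚ (map term (map (i ∷_) (comps m s))) ≡ g i (l - ι s) * sumComps m s g l
  first-index i s = begin
      sumℚ (map term (map (i ∷_) (comps m s)))
    ≡⟨ cong sumℚ (ListP.map-∘ (comps m s)) ⟨
      sumℚ (map (λ is → g i (l - ι (sumℕVec is)) * prodTuple g is l) (comps m s))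
    ≡⟨ cong sumℚ (ListP.map-cong-local (All.map (λ {is} Σis≡s → cong (λ n → g i (l - ι n) * prodTuple g is l) Σis≡s) (comps-sum m s))) ⟩
      sumℚ (map (λ is → g i (l - ι s) * prodTuple g is l) (comps m s))
    ≡⟨ sumℚ-map-*ˡ (g i (l - ι s)) (λ is → prodTuple g is l) (comps m s) ⟩
      g i (l - ι s) * sumComps m s g l
    ∎

Δ!-pow : ∀ f m t l → Δ! t (λ x → pow (f x) m) l ≡ sumComps m t (λ i → Δ! i f) l
Δ!-pow f zero    zero    l = refl
Δ!-pow f zero    (suc t) l = trans (cong (_* invFact (suc t)) (Δ^-suc-const t 1ℚ l)) (ℚP.*-zeroˡ (invFact (suc t)))
Δ!-pow f (suc m) t       l = begin
    Δ! t (λ x → pow (f x) m * f x) l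
  ≡⟨ Δ!-leibniz t f (λ x → pow (f x) m) l ⟩
    antidiagonalSum (λ i j → Δ! i f (l - ι j) * Δ! j (λ x → pow (f x) m) l) t
  ≡⟨ antidiagonalSum-cong _ _ t (λ i j _ → cong (Δ! i f (l - ι j) *_) (Δ!-pow f m j l)) ⟩
    antidiagonalSum (λ i j → Δ! i f (l - ι j) * sumComps m j (λ i → Δ! i f) l) t
  ≡⟨ sumComps-suc (λ i → Δ! i f) l m t ⟨
    sumComps (suc m) t (λ i → Δ! i f) l
  ∎
  where open ≡-Reasoning

pow-+ : ∀ x m n → pow x (m ℕ.+ n) ≡ pow x m * pow x n
pow-+ x zero    n = sym (ℚP.*-identityˡ (pow x n))
pow-+ x (suc m) n = trans (cong (_* x) (pow-+ x m n))
  (ring 3 (λ a b x → a :* b :* x := a :* x :* b) refl (pow x m) (pow x n) x)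

sumComps-pow-factor : ∀ h g₁ g₂ → (∀ i y → g₁ i y ≡ pow h i * g₂ i y) →
                      ∀ m t l → sumComps m t g₁ l ≡ pow h t * sumComps m t g₂ l
sumComps-pow-factor h g₁ g₂ g₁≡hⁱg₂ m t l = begin
    sumℚ (map (λ is → prodTuple g₁ is l) (comps m t))
  ≡⟨ cong sumℚ (ListP.map-cong-local (All.map (λ {is} Σis≡t → trans (prodTuple-factor is) (cong (λ n → pow h n * prodTuple g₂ is l) Σis≡t))
                                               (comps-sum m t))) ⟩
    sumℚ (map (λ is → pow h t * prodTuple g₂ is l) (comps m t))
  ≡⟨ sumℚ-map-*ˡ (pow h t) (λ is → prodTuple g₂ is l) (comps m t) ⟩
    pow h t * sumComps m t g₂ l
  ∎
  where
  open ≡-Reasoning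
  prodTuple-factor : ∀ {n} (is : Vec ℕ n) → prodTuple g₁ is l ≡ pow h (sumℕVec is) * prodTuple g₂ is l
  prodTuple-factor []       = sym (ℚP.*-identityˡ 1ℚ)
  prodTuple-factor (i ∷ is) = begin
      g₁ i y * prodTuple g₁ is l
    ≡⟨ cong₂ _*_ (g₁≡hⁱg₂ i y) (prodTuple-factor is) ⟩
      (pow h i * g₂ i y) * (pow h (sumℕVec is) * prodTuple g₂ is l)
    ≡⟨ ring 4 (λ a b c d → (a :* b) :* (c :* d) := (a :* c) :* (b :* d)) refl (pow h i) (g₂ i y) (pow h (sumℕVec is)) (prodTuple g₂ is l) ⟩
      (pow h i * pow h (sumℕVec is)) * (g₂ i y * prodTuple g₂ is l)
    ≡⟨ cong (_* (g₂ i y * prodTuple g₂ is l)) (pow-+ h i (sumℕVec is)) ⟨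
      pow h (i ℕ.+ sumℕVec is) * (g₂ i y * prodTuple g₂ is l)
    ∎
    where
    y : ℚ
    y = l - ι (sumℕVec is)

Δ!-P : ∀ h k i y → Δ! i (P h k) y ≡ pow h i * (ι (ff k i) * invFact i * P h (k ∸ i) y)
Δ!-P h k i y = trans (cong (_* invFact i) (Δ^-P h k i y))
  (ring 4 (λ a b p c → a :* b :* p :* c := a :* (b :* c :* p)) refl (pow h i) (ι (ff k i)) (P h (k ∸ i) y) (invFact i))

proposition5p8 : (m k t : ℕ) → 0 < m → 0 < k → (h l : ℚ) →
    ((Δ^ t (λ x → pow (P h k x) m) l * invFact t
        ≡ sumComps m t (λ i y → Δ^ i (P h k) y * invFact i) l)
    × (sumComps m t (λ i y → Δ^ i (P h k) y * invFact i) l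
        ≡ pow h t * sumComps m t (λ i y → ι (ff k i) * invFact i * P h (k ∸ i) y) l))
proposition5p8 m k t _ _ h l =
  Δ!-pow (P h k) m t l , sumComps-pow-factor h _ _ (Δ!-P h k) m t l
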